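{- Let $X_{\ell},Y_{\ell},X_{r},Y_{r}$ be sets with $X_{\ell}\cap X_{r}=\{x\}$, $Y_{\ell}\cap Y_{r}=\{y\}$, $X_{\ell}$ disjoint from $Y_{\ell}$ and $Y_{r}$, and $X_{r}$ disjoint from $Y_{\ell}$ and $Y_{r}$. Let $B_{\ell}\in\mathbb{Q}^{X_{\ell}\times Y_{\ell}}$ and $B_{r}\in\mathbb{Q}^{X_{r}\times Y_{r}}$ be totally unimodular, and suppose $r=B_{\ell}(x,Y_{\ell})$ and $c=B_{r}(X_{r},y)$ are nonzero. Let $A_{r}=B_{r}(X_{r},Y_{r}\setminus\{y\})$ and $D\in\mathbb{Q}^{X_{r}\times Y_{\ell}}$ with $D(i,j)=c(i)\,r(j)$. Then the matrix $\begin{bmatrix}D&A_{r}\end{bmatrix}\in\mathbb{Q}^{X_{r}\times(Y_{\ell}\cup(Y_{r}\setminus\{y\}))}$ is totally unimodular.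
   Context: A matrix $A\in\mathbb{Q}^{X\times Y}$ ($X,Y$ arbitrary sets) is totally unimodular if for every $k\in\mathbb{N}$ every $k\times k$ submatrix (choose $k$ rows and $k$ columns, not necessarily contiguous) has determinant in $\{0,\pm1\}$. -}

module Defs where

open import Data.Nat using (ℕ; zero; suc)
open import Data.Fin using (Fin; zero; suc; toℕ; punchIn)
open import Data.Rational using (ℚ; 0ℚ; 1ℚ; _+_; _*_; -_)
open import Data.Sum using (_⊎_; inj₁; inj₂)
open import Relation.Binary.PropositionalEquality using (_≡_)
open import Function.Definitions using (Injective)

sumFin : ∀ {n} → (Fin n → ℚ) → ℚ
sumFin {zero}  f = 0ℚ
sumFin {suc n} f = f zero + sumFin (λ i → f (suc i))

sign : ℕ → ℚ
sign zero    = 1ℚ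
sign (suc n) = - sign n

det : ∀ {k} → (Fin k → Fin k → ℚ) → ℚ
det {zero}  M = 1ℚ
det {suc k} M =
  sumFin (λ j → (sign (toℕ j) * M zero j) * det (λ a b → M (suc a) (punchIn j b)))

Matrix : Set → Set → Set
Matrix X Y = X → Y → ℚ

InZeroPmOne : ℚ → Set
InZeroPmOne d = d ≡ 0ℚ ⊎ (d ≡ 1ℚ ⊎ d ≡ - 1ℚ)

TotallyUnimodular : {X Y : Set} → Matrix X Y → Set
TotallyUnimodular {X} {Y} A =
  (k : ℕ) (f : Fin k → X) (g : Fin k → Y) →
  Injective _≡_ _≡_ f → Injective _≡_ _≡_ g →
  InZeroPmOne (det (λ a b → A (f a) (g b)))

open import Data.Product using (Σ; _,_)
open import Relation.Binary.PropositionalEquality using (_≢_)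

-- the matrix [ D  A_r ] with D(i,j) = c(i) r(j), r = Bℓ(x, Yℓ), c = Br(Xr, y),
-- A_r = Br(Xr, Yr \ {y}); columns indexed by Yℓ ∪ (Yr \ {y}) (a disjoint union)
concatMatrix : {Xℓ Yℓ Xr Yr : Set} (x : Xℓ) (y : Yr) →
  Matrix Xℓ Yℓ → Matrix Xr Yr → Matrix Xr (Yℓ ⊎ Σ Yr (λ j → j ≢ y))
concatMatrix x y Bℓ Br i (inj₁ j)       = Br i y * Bℓ x j
concatMatrix x y Bℓ Br i (inj₂ (j , _)) = Br i j

{-# OPTIONS --safe #-}
-- Each column of [D A_r] is a column of B_r scaled by a number in {0, ±1}: column j of D
-- is c scaled by the entry r(j) of B_ℓ, and the columns of A_r are scaled by 1.  A square
-- submatrix of [D A_r] is therefore a square submatrix of B_r, possibly with repeated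
-- columns, whose columns are then scaled.  Scaling multiplies the determinant by a product
-- of numbers in {0, ±1}, and a repeated column makes it 0.
module Submission where

open import Defs
open import Data.Rational using (ℚ; 0ℚ; _*_)
open import Data.Product using (Σ; _,_)
open import Data.Sum using (_⊎_; inj₁; inj₂)
open import Relation.Nullary using (¬_)
open import Relation.Binary.PropositionalEquality using (_≡_; _≢_)

open import Data.Nat using (zero; suc)
import Data.Nat as ℕ
open import Data.Fin using (Fin; zero; suc; toℕ; punchIn; inject₁; _<_)
open import Data.Fin.Properties using (_≟_; <-cmp; <⇒≢; ≤∧≢⇒<; toℕ-inject₁)
open import Data.Fin.Induction using (<-weakInduction)
open import Data.Rational using (1ℚ; _+_; -_; ½)
import Data.Rational.Properties as ℚ
open import Data.Rational.Solver using (module +-*-Solver)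
open import Function using (_∘_)
open import Function.Definitions using (Injective)
open import Relation.Binary.Definitions using (tri<; tri≈; tri>)
open import Relation.Binary.PropositionalEquality
  using (refl; sym; trans; cong; cong₂; subst; module ≡-Reasoning)
open import Relation.Nullary using (Dec; yes; no; contradiction)
open import Relation.Nullary.Decidable using (_⊎-dec_)

open +-*-Solver

sumFin-cong : ∀ {n} {f g : Fin n → ℚ} → (∀ i → f i ≡ g i) → sumFin f ≡ sumFin g
sumFin-cong {zero}  f≗g = refl
sumFin-cong {suc n} f≗g = cong₂ _+_ (f≗g zero) (sumFin-cong (f≗g ∘ suc))

sumFin-neg : ∀ {n} (f : Fin n → ℚ) → sumFin (λ i → - f i) ≡ - sumFin f
sumFin-neg {zero}  f = refl
sumFin-neg {suc n} f = trans (cong (- f zero +_) (sumFin-neg (f ∘ suc)))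
                             (sym (ℚ.neg-distrib-+ (f zero) (sumFin (f ∘ suc))))

sumFin-*-distribˡ : ∀ {n} (c : ℚ) (f : Fin n → ℚ) → sumFin (λ i → c * f i) ≡ c * sumFin f
sumFin-*-distribˡ {zero}  c f = sym (ℚ.*-zeroʳ c)
sumFin-*-distribˡ {suc n} c f = trans (cong (c * f zero +_) (sumFin-*-distribˡ c (f ∘ suc)))
                                      (sym (ℚ.*-distribˡ-+ c (f zero) (sumFin (f ∘ suc))))

prodFin : ∀ {n} → (Fin n → ℚ) → ℚ
prodFin {zero}  f = 1ℚ
prodFin {suc n} f = f zero * prodFin (f ∘ suc)

prodFin-punchIn : ∀ {n} (f : Fin (suc n) → ℚ) (j : Fin (suc n)) →
  prodFin f ≡ f j * prodFin (f ∘ punchIn j)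
prodFin-punchIn         f zero    = refl
prodFin-punchIn {suc n} f (suc j) =
  trans (cong (f zero *_) (prodFin-punchIn (f ∘ suc) j))
        (solve 3 (λ a b c → a :* (b :* c) := b :* (a :* c)) refl
           (f zero) (f (suc j)) (prodFin (f ∘ suc ∘ punchIn j)))

swapAdjacent : ∀ {n} → Fin n → Fin (suc n) → Fin (suc n)
swapAdjacent zero    zero          = suc zero
swapAdjacent zero    (suc zero)    = zero
swapAdjacent zero    (suc (suc j)) = suc (suc j)
swapAdjacent (suc i) zero          = zero
swapAdjacent (suc i) (suc j)       = suc (swapAdjacent i j)

swapAdjacent-inject₁ : ∀ {n} (i : Fin n) → swapAdjacent i (inject₁ i) ≡ suc i
swapAdjacent-inject₁ zero    = refl
swapAdjacent-inject₁ (suc i) = cong suc (swapAdjacent-inject₁ i)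

swapAdjacent-suc : ∀ {n} (i : Fin n) → swapAdjacent i (suc i) ≡ inject₁ i
swapAdjacent-suc zero    = refl
swapAdjacent-suc (suc i) = cong suc (swapAdjacent-suc i)

swapAdjacent-other : ∀ {n} (i : Fin n) {j} → j ≢ inject₁ i → j ≢ suc i → swapAdjacent i j ≡ j
swapAdjacent-other zero    {zero}        j≢i j≢1+i = contradiction refl j≢i
swapAdjacent-other zero    {suc zero}    j≢i j≢1+i = contradiction refl j≢1+i
swapAdjacent-other zero    {suc (suc j)} j≢i j≢1+i = refl
swapAdjacent-other (suc i) {zero}        j≢i j≢1+i = refl
swapAdjacent-other (suc i) {suc j}       j≢i j≢1+i =
  cong suc (swapAdjacent-other i (j≢i ∘ cong suc) (j≢1+i ∘ cong suc))

swapAdjacent-punchIn-inject₁ : ∀ {n} (i : Fin n) b →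
  swapAdjacent i (punchIn (inject₁ i) b) ≡ punchIn (suc i) b
swapAdjacent-punchIn-inject₁ zero    zero    = refl
swapAdjacent-punchIn-inject₁ zero    (suc b) = refl
swapAdjacent-punchIn-inject₁ (suc i) zero    = refl
swapAdjacent-punchIn-inject₁ (suc i) (suc b) = cong suc (swapAdjacent-punchIn-inject₁ i b)

swapAdjacent-punchIn-suc : ∀ {n} (i : Fin n) b →
  swapAdjacent i (punchIn (suc i) b) ≡ punchIn (inject₁ i) b
swapAdjacent-punchIn-suc zero    zero    = refl
swapAdjacent-punchIn-suc zero    (suc b) = refl
swapAdjacent-punchIn-suc (suc i) zero    = refl
swapAdjacent-punchIn-suc (suc i) (suc b) = cong suc (swapAdjacent-punchIn-suc i b)

swapAdjacent-punchIn-commute : ∀ {m} (i : Fin (suc m)) {j} → j ≢ inject₁ i → j ≢ suc i →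
  Σ (Fin m) λ i′ → ∀ b → swapAdjacent i (punchIn j b) ≡ punchIn j (swapAdjacent i′ b)
swapAdjacent-punchIn-commute zero {zero}       j≢i j≢1+i = contradiction refl j≢i
swapAdjacent-punchIn-commute zero {suc zero}   j≢i j≢1+i = contradiction refl j≢1+i
swapAdjacent-punchIn-commute {suc m} zero {suc (suc j)} j≢i j≢1+i =
  zero , λ { zero → refl ; (suc zero) → refl ; (suc (suc b)) → refl }
swapAdjacent-punchIn-commute (suc i) {zero} j≢i j≢1+i = i , λ b → refl
swapAdjacent-punchIn-commute {suc m} (suc i) {suc j} j≢i j≢1+i
  with i′ , commute ← swapAdjacent-punchIn-commute i (j≢i ∘ cong suc) (j≢1+i ∘ cong suc) =
  suc i′ , λ { zero → refl ; (suc b) → cong suc (commute b) }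

sumFin-swapAdjacent : ∀ {n} (i : Fin n) (f : Fin (suc n) → ℚ) →
  sumFin (f ∘ swapAdjacent i) ≡ sumFin f
sumFin-swapAdjacent zero f =
  solve 3 (λ a b c → a :+ (b :+ c) := b :+ (a :+ c)) refl
    (f (suc zero)) (f zero) (sumFin (λ j → f (suc (suc j))))
sumFin-swapAdjacent (suc i) f = cong (f zero +_) (sumFin-swapAdjacent i (f ∘ suc))

minor : ∀ {k} → (Fin (suc k) → Fin (suc k) → ℚ) → Fin (suc k) → Fin k → Fin k → ℚ
minor M j a b = M (suc a) (punchIn j b)

laplaceTerm : ∀ {k} → (Fin (suc k) → Fin (suc k) → ℚ) → Fin (suc k) → ℚ
laplaceTerm M j = (sign (toℕ j) * M zero j) * det (minor M j)

det-cong : ∀ {k} {M N : Fin k → Fin k → ℚ} → (∀ a b → M a b ≡ N a b) → det M ≡ det N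
det-cong {zero}  M≗N = refl
det-cong {suc k} M≗N = sumFin-cong λ j →
  cong₂ _*_ (cong (sign (toℕ j) *_) (M≗N zero j)) (det-cong λ a b → M≗N (suc a) (punchIn j b))

det-scaleColumns : ∀ {k} (M : Fin k → Fin k → ℚ) (s : Fin k → ℚ) →
  det (λ a b → M a b * s b) ≡ prodFin s * det M
det-scaleColumns {zero}  M s = refl
det-scaleColumns {suc k} M s =
  trans (sumFin-cong term) (sumFin-*-distribˡ (prodFin s) (laplaceTerm M))
  where
  open ≡-Reasoning
  term : ∀ j → laplaceTerm (λ a b → M a b * s b) j ≡ prodFin s * laplaceTerm M j
  term j = begin
      (sign (toℕ j) * (M zero j * s j)) * det (λ a b → minor M j a b * s (punchIn j b))
    ≡⟨ cong ((sign (toℕ j) * (M zero j * s j)) *_) (det-scaleColumns (minor M j) (s ∘ punchIn j)) ⟩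
      (sign (toℕ j) * (M zero j * s j)) * (prodFin (s ∘ punchIn j) * det (minor M j))
    ≡⟨ solve 5 (λ σ m sⱼ p d → (σ :* (m :* sⱼ)) :* (p :* d) := (sⱼ :* p) :* ((σ :* m) :* d)) refl
         (sign (toℕ j)) (M zero j) (s j) (prodFin (s ∘ punchIn j)) (det (minor M j)) ⟩
      (s j * prodFin (s ∘ punchIn j)) * laplaceTerm M j
    ≡⟨ cong (_* laplaceTerm M j) (sym (prodFin-punchIn s j)) ⟩
      prodFin s * laplaceTerm M j
    ∎

det-swapAdjacentColumns : ∀ {n} (i : Fin n) (M : Fin (suc n) → Fin (suc n) → ℚ) →
  det (λ a b → M a (swapAdjacent i b)) ≡ - det M
det-swapAdjacentColumns {suc m} i M = begin
    sumFin (laplaceTerm M′)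
  ≡⟨ sumFin-cong term ⟩
    sumFin (λ j → - laplaceTerm M (swapAdjacent i j))
  ≡⟨ sumFin-swapAdjacent i (λ j → - laplaceTerm M j) ⟩
    sumFin (λ j → - laplaceTerm M j)
  ≡⟨ sumFin-neg (laplaceTerm M) ⟩
    - det M
  ∎
  where
  open ≡-Reasoning
  M′ : Fin (suc (suc m)) → Fin (suc (suc m)) → ℚ
  M′ a b = M a (swapAdjacent i b)
  term : ∀ j → laplaceTerm M′ j ≡ - laplaceTerm M (swapAdjacent i j)
  term j with j ≟ inject₁ i | j ≟ suc i
  ... | yes refl | _ rewrite swapAdjacent-inject₁ i | toℕ-inject₁ i =
    trans (cong ((sign (toℕ i) * M zero (suc i)) *_)
                (det-cong λ a b → cong (M (suc a)) (swapAdjacent-punchIn-inject₁ i b)))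
          (solve 3 (λ σ m d → (σ :* m) :* d := :- ((:- σ :* m) :* d)) refl
             (sign (toℕ i)) (M zero (suc i)) (det (minor M (suc i))))
  ... | no _ | yes refl rewrite swapAdjacent-suc i | toℕ-inject₁ i =
    trans (cong ((- sign (toℕ i) * M zero (inject₁ i)) *_)
                (det-cong λ a b → cong (M (suc a)) (swapAdjacent-punchIn-suc i b)))
          (solve 3 (λ σ m d → (:- σ :* m) :* d := :- ((σ :* m) :* d)) refl
             (sign (toℕ i)) (M zero (inject₁ i)) (det (minor M (inject₁ i))))
  ... | no j≢i | no j≢1+i
    with i′ , commute ← swapAdjacent-punchIn-commute i j≢i j≢1+i
    rewrite swapAdjacent-other i j≢i j≢1+i =
    trans (cong ((sign (toℕ j) * M zero j) *_)
                (trans (det-cong λ a b → cong (M (suc a)) (commute b))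
                       (det-swapAdjacentColumns i′ (minor M j))))
          (sym (ℚ.neg-distribʳ-* (sign (toℕ j) * M zero j) (det (minor M j))))

x≡-x⇒x≡0 : ∀ x → x ≡ - x → x ≡ 0ℚ
x≡-x⇒x≡0 x x≡-x = begin
  x             ≡⟨ solve 1 (λ x → x := con ½ :* (x :+ x)) refl x ⟩
  ½ * (x + x)   ≡⟨ cong (λ y → ½ * (x + y)) x≡-x ⟩
  ½ * (x + - x) ≡⟨ cong (½ *_) (ℚ.+-inverseʳ x) ⟩
  ½ * 0ℚ        ≡⟨ ℚ.*-zeroʳ ½ ⟩
  0ℚ            ∎
  where open ≡-Reasoning

det-equalAdjacentColumns : ∀ {n} (i : Fin n) (M : Fin (suc n) → Fin (suc n) → ℚ) →
  (∀ a → M a (inject₁ i) ≡ M a (suc i)) → det M ≡ 0ℚ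
det-equalAdjacentColumns i M i≗1+i =
  x≡-x⇒x≡0 (det M) (trans (det-cong λ a b → sym (swapped a b)) (det-swapAdjacentColumns i M))
  where
  swapped : ∀ a b → M a (swapAdjacent i b) ≡ M a b
  swapped a b with b ≟ inject₁ i | b ≟ suc i
  ... | yes refl | _        rewrite swapAdjacent-inject₁ i = sym (i≗1+i a)
  ... | no _     | yes refl rewrite swapAdjacent-suc i     = i≗1+i a
  ... | no b≢i   | no b≢1+i = cong (M a) (swapAdjacent-other i b≢i b≢1+i)

det-equalColumns< : ∀ {n} (M : Fin (suc n) → Fin (suc n) → ℚ) {p q} → p < q →
  (∀ a → M a p ≡ M a q) → det M ≡ 0ℚ
det-equalColumns< {n} M {q = q} = <-weakInduction P (λ _ ()) step q M
  where
  P : Fin (suc n) → Set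
  P q = ∀ M {p} → p < q → (∀ a → M a p ≡ M a q) → det M ≡ 0ℚ
  -- Swapping columns inject₁ i and suc i only negates det M, and it moves the copy of
  -- column p from position suc i down to inject₁ i.
  step : ∀ i → P (inject₁ i) → P (suc i)
  step i ih M {p} p<1+i p≗1+i with p ≟ inject₁ i
  ... | yes refl = det-equalAdjacentColumns i M p≗1+i
  ... | no p≢i = ℚ.neg-injective (trans (sym (det-swapAdjacentColumns i M)) (ih _ p<i p≗i))
    where
    p<i : p < inject₁ i
    p<i = ≤∧≢⇒< (subst (toℕ p ℕ.≤_) (sym (toℕ-inject₁ i)) (ℕ.s≤s⁻¹ p<1+i)) p≢i
    p≗i : ∀ a → M a (swapAdjacent i p) ≡ M a (swapAdjacent i (inject₁ i))
    p≗i a = trans (cong (M a) (swapAdjacent-other i p≢i (<⇒≢ p<1+i)))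
                  (trans (p≗1+i a) (cong (M a) (sym (swapAdjacent-inject₁ i))))

det-equalColumns : ∀ {n} (M : Fin n → Fin n → ℚ) {p q} → p ≢ q →
  (∀ a → M a p ≡ M a q) → det M ≡ 0ℚ
det-equalColumns {suc n} M {p} {q} p≢q p≗q with <-cmp p q
... | tri< p<q _ _ = det-equalColumns< M p<q p≗q
... | tri≈ _ p≡q _ = contradiction p≡q p≢q
... | tri> _ _ q<p = det-equalColumns< M q<p (sym ∘ p≗q)

InZeroPmOne? : ∀ d → Dec (InZeroPmOne d)
InZeroPmOne? d = (d ℚ.≟ 0ℚ) ⊎-dec ((d ℚ.≟ 1ℚ) ⊎-dec (d ℚ.≟ - 1ℚ))

InZeroPmOne-* : ∀ {d e} → InZeroPmOne d → InZeroPmOne e → InZeroPmOne (d * e)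
InZeroPmOne-* {e = e} (inj₁ refl)        _                  = inj₁ (ℚ.*-zeroˡ e)
InZeroPmOne-* {e = e} (inj₂ (inj₁ refl)) e∈                 =
  subst InZeroPmOne (sym (ℚ.*-identityˡ e)) e∈
InZeroPmOne-*         (inj₂ (inj₂ refl)) (inj₁ refl)        = inj₁ refl
InZeroPmOne-*         (inj₂ (inj₂ refl)) (inj₂ (inj₁ refl)) = inj₂ (inj₂ refl)
InZeroPmOne-*         (inj₂ (inj₂ refl)) (inj₂ (inj₂ refl)) = inj₂ (inj₁ refl)

InZeroPmOne-prodFin : ∀ {n} (f : Fin n → ℚ) → (∀ i → InZeroPmOne (f i)) → InZeroPmOne (prodFin f)
InZeroPmOne-prodFin {zero}  f f∈ = inj₂ (inj₁ refl)
InZeroPmOne-prodFin {suc n} f f∈ =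
  InZeroPmOne-* (f∈ zero) (InZeroPmOne-prodFin (f ∘ suc) (f∈ ∘ suc))

TotallyUnimodular-entry : {X Y : Set} {B : Matrix X Y} → TotallyUnimodular B →
  ∀ i j → InZeroPmOne (B i j)
TotallyUnimodular-entry {B = B} tu i j =
  subst InZeroPmOne (trans (ℚ.+-identityʳ _) (trans (ℚ.*-identityʳ _) (ℚ.*-identityˡ (B i j))))
    (tu 1 (λ _ → i) (λ _ → j) const-injective const-injective)
  where
  const-injective : ∀ {A : Set} {h : Fin 1 → A} → Injective _≡_ _≡_ h
  const-injective {x = zero} {y = zero} _ = refl

TotallyUnimodular-cong : {X Y : Set} {A B : Matrix X Y} → (∀ i j → A i j ≡ B i j) →
  TotallyUnimodular A → TotallyUnimodular B
TotallyUnimodular-cong A≗B tu k f g f-inj g-inj =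
  subst InZeroPmOne (det-cong λ a b → A≗B (f a) (g b)) (tu k f g f-inj g-inj)

reindexColumns : {X Y Z : Set} → Matrix X Y → (Z → Y) → Matrix X Z
reindexColumns B h i z = B i (h z)

scaleColumns : {X Y : Set} → Matrix X Y → (Y → ℚ) → Matrix X Y
scaleColumns B s i j = B i j * s j

TotallyUnimodular-reindexColumns : {X Y Z : Set} {B : Matrix X Y} → TotallyUnimodular B →
  (h : Z → Y) → TotallyUnimodular (reindexColumns B h)
TotallyUnimodular-reindexColumns {B = B} tu h k f g f-inj _
  with InZeroPmOne? (det (λ a b → B (f a) (h (g b))))
... | yes d∈ = d∈
... | no d∉ = tu k f (h ∘ g) f-inj h∘g-inj
  where
  -- Equality on Y need not be decidable, but membership in {0, ±1} is: once the minor is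
  -- known to lie outside {0, ±1}, two of its columns cannot coincide.
  h∘g-inj : Injective _≡_ _≡_ (h ∘ g)
  h∘g-inj {b} {b′} e with b ≟ b′
  ... | yes b≡b′ = b≡b′
  ... | no b≢b′ = contradiction
    (inj₁ (det-equalColumns (λ a b → B (f a) (h (g b))) b≢b′ λ a → cong (B (f a)) e)) d∉

TotallyUnimodular-scaleColumns : {X Y : Set} {B : Matrix X Y} → TotallyUnimodular B →
  (s : Y → ℚ) → (∀ j → InZeroPmOne (s j)) → TotallyUnimodular (scaleColumns B s)
TotallyUnimodular-scaleColumns {B = B} tu s s∈ k f g f-inj g-inj =
  subst InZeroPmOne (sym (det-scaleColumns (λ a b → B (f a) (g b)) (s ∘ g)))
    (InZeroPmOne-* (InZeroPmOne-prodFin (s ∘ g) (s∈ ∘ g)) (tu k f g f-inj g-inj))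

mainTheorem13 : (Xℓ Yℓ Xr Yr : Set) (x : Xℓ) (y : Yr)
    (Bℓ : Matrix Xℓ Yℓ) (Br : Matrix Xr Yr) →
    TotallyUnimodular Bℓ → TotallyUnimodular Br →
    ¬ ((j : Yℓ) → Bℓ x j ≡ 0ℚ) →
    ¬ ((i : Xr) → Br i y ≡ 0ℚ) →
    TotallyUnimodular (concatMatrix x y Bℓ Br)
mainTheorem13 Xℓ Yℓ Xr Yr x y Bℓ Br tuℓ tur _ _ =
  TotallyUnimodular-cong factor
    (TotallyUnimodular-scaleColumns {B = reindexColumns Br column}
      (TotallyUnimodular-reindexColumns {B = Br} tur column) scale scale∈)
  where
  Column : Set
  Column = Yℓ ⊎ Σ Yr (λ j → j ≢ y)
  column : Column → Yr
  column (inj₁ _)       = y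
  column (inj₂ (j , _)) = j
  scale : Column → ℚ
  scale (inj₁ j) = Bℓ x j
  scale (inj₂ _) = 1ℚ
  scale∈ : ∀ c → InZeroPmOne (scale c)
  scale∈ (inj₁ j) = TotallyUnimodular-entry tuℓ x j
  scale∈ (inj₂ _) = inj₂ (inj₁ refl)
  factor : ∀ i c → scaleColumns (reindexColumns Br column) scale i c ≡ concatMatrix x y Bℓ Br i c
  factor i (inj₁ _)       = refl
  factor i (inj₂ (j , _)) = ℚ.*-identityʳ (Br i j)
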